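{- Let $\mathbf{a}=(a_n)_{n\geq 1}$ be a strong divisibility sequence. Then for every positive integer $n$, \[\mathrm{lcm}(a_1,a_2,\dots,a_n)=\mathrm{lcm}\left\{a_1\binom{n}{1}_{\mathbf{a}},a_2\binom{n}{2}_{\mathbf{a}},\dots,a_n\binom{n}{n}_{\mathbf{a}}\right\}.\]
   Context: A strong divisibility sequence is a sequence of positive integers $(a_n)_{n\geq 1}$ such that $\gcd(a_n,a_m)=a_{\gcd(n,m)}$ for all positive integers $n,m$. For $n,k\in\mathbb{N}$ with $n\geq k$, the $\mathbf{a}$-binomial coefficient is $\binom{n}{k}_{\mathbf{a}}:=\frac{a_na_{n-1}\cdots a_{n-k+1}}{a_1a_2\cdots a_k}$ (an empty product being $1$); for strong divisibility sequences these are positive integers. -}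

module Defs where

open import Data.Nat using (ℕ; zero; suc; _+_; _*_; _∸_; _<_; _≤_; NonZero; >-nonZero)
open import Data.Nat.Properties using (m*n≢0)
open import Data.Nat.DivMod using (_/_)
open import Data.Nat.GCD using (gcd)
open import Data.Nat.LCM using (lcm)

-- A sequence of positive integers (a_n)_{n ≥ 1} is modelled as a : ℕ → ℕ;
-- the value a 0 is irrelevant and never used.
Positive : (ℕ → ℕ) → Set
Positive a = ∀ n → 1 ≤ n → 0 < a n

IsStrongDivisibilitySequence : (ℕ → ℕ) → Set
IsStrongDivisibilitySequence a =
  Positive a × (∀ n m → 1 ≤ n → 1 ≤ m → gcd (a n) (a m) ≡ a (gcd n m))
  where
  open import Data.Product using (_×_)
  open import Relation.Binary.PropositionalEquality using (_≡_)

prodInit : (ℕ → ℕ) → ℕ → ℕ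
prodInit a zero    = 1
prodInit a (suc k) = prodInit a k * a (suc k)

fallProd : (ℕ → ℕ) → ℕ → ℕ → ℕ
fallProd a n zero    = 1
fallProd a n (suc k) = a (n ∸ k) * fallProd a n k

prodInit-nonZero : (a : ℕ → ℕ) → Positive a → ∀ k → NonZero (prodInit a k)
prodInit-nonZero a pos zero    = _
prodInit-nonZero a pos (suc k) =
  m*n≢0 (prodInit a k) (a (suc k))
    {{prodInit-nonZero a pos k}} {{>-nonZero (pos (suc k) (Data.Nat.s≤s Data.Nat.z≤n))}}
  where import Data.Nat

aBinom : (a : ℕ → ℕ) → Positive a → ℕ → ℕ → ℕ
aBinom a pos n k = (fallProd a n k / prodInit a k) {{prodInit-nonZero a pos k}}

lcmUpTo : (ℕ → ℕ) → ℕ → ℕ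
lcmUpTo f zero    = 1
lcmUpTo f (suc n) = lcm (lcmUpTo f n) (f (suc n))

{-# OPTIONS --safe #-}
-- Fix a prime p and e ≥ 1. Since gcd(a_i, a_j) = a_gcd(i,j), the indices i ≥ 1 with p^e ∣ a_i are
-- closed under gcd and under taking multiples, so among 1, …, n they are exactly the multiples of
-- one number D (the rank of apparition of p^e). Summing over e, the exponent of p in a_1 ⋯ a_m is
-- Σ_e ⌊m/D_e⌋ for m ≤ n. Then ⌊k/D⌋ + ⌊(n−k)/D⌋ ≤ ⌊n/D⌋ shows that a_1 ⋯ a_k divides
-- a_n ⋯ a_{n−k+1}. Moreover ⌊n/D⌋ ≤ ⌊k/D⌋ + ⌊(n−k)/D⌋ + [D ∤ k], and ⌊n/D⌋ > 0 forces D ≤ n, hence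
-- p^e ∣ lcm(a_1, …, a_n); so a_k (n choose k)_a divides the lcm.
module Submission where

open import Defs
open import Data.Nat using (ℕ; _*_; _≤_)
open import Data.Product using (proj₁)
open import Relation.Binary.PropositionalEquality using (_≡_)

open import Data.Nat.Base
open import Data.Nat.Properties
open import Algebra.Properties.CommutativeSemigroup +-commutativeSemigroup using (interchange)
open import Data.Nat.Divisibility
open import Data.Nat.DivMod
open import Data.Nat.GCD using (gcd; gcd[m,n]∣m; gcd[m,n]∣n; gcd-greatest; gcd-identityˡ)
open import Data.Nat.LCM using (lcm; m∣lcm[m,n]; n∣lcm[m,n]; lcm-least; gcd*lcm)
open import Data.Nat.ListAction using (product)
open import Data.Nat.Primality using (Prime; prime⇒nonZero; prime⇒nonTrivial; euclidsLemma; productOfPrimes≥1)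
open import Data.Nat.Primality.Factorisation using (factorise; PrimeFactorisation)
open import Data.Nat.Tactic.RingSolver using (solve-∀)
open import Data.List.Base using ([]; _∷_)
open import Data.List.Relation.Unary.All using (All; []; _∷_)
open import Data.Product using (_,_; proj₂; _×_; ∃-syntax)
open import Data.Sum using (inj₁; inj₂; [_,_]′)
open import Function.Base using (_∘_)
open import Function.Bundles using (_⇔_; mk⇔; Equivalence)
open import Relation.Nullary using (Dec; yes; no; ¬_; contradiction)
open import Relation.Unary using (Decidable)
open import Relation.Binary.PropositionalEquality
  using (refl; sym; trans; cong; cong₂; subst; subst₂; module ≡-Reasoning)

𝟙 : {P : Set} → Dec P → ℕ
𝟙 (yes _) = 1
𝟙 (no _)  = 0

𝟙≤1 : {P : Set} (d : Dec P) → 𝟙 d ≤ 1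
𝟙≤1 (yes _) = ≤-refl
𝟙≤1 (no _)  = z≤n

𝟙-no : {P : Set} → ¬ P → (d : Dec P) → 𝟙 d ≡ 0
𝟙-no ¬p (yes p) = contradiction p ¬p
𝟙-no ¬p (no _)  = refl

𝟙-cong : {P Q : Set} → P ⇔ Q → (d : Dec P) (d′ : Dec Q) → 𝟙 d ≡ 𝟙 d′
𝟙-cong P⇔Q (yes _) (yes _) = refl
𝟙-cong P⇔Q (yes p) (no ¬q) = contradiction (Equivalence.to P⇔Q p) ¬q
𝟙-cong P⇔Q (no ¬p) (yes q) = contradiction (Equivalence.from P⇔Q q) ¬p
𝟙-cong P⇔Q (no _)  (no _)  = refl

sumUpTo : (ℕ → ℕ) → ℕ → ℕ
sumUpTo f zero    = 0
sumUpTo f (suc m) = sumUpTo f m + f (suc m)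

sumUpTo-cong : ∀ {f g} m → (∀ i → 1 ≤ i → i ≤ m → f i ≡ g i) → sumUpTo f m ≡ sumUpTo g m
sumUpTo-cong zero    f≗g = refl
sumUpTo-cong (suc m) f≗g =
  cong₂ _+_ (sumUpTo-cong m (λ i 1≤i i≤m → f≗g i 1≤i (m≤n⇒m≤1+n i≤m))) (f≗g (suc m) z<s ≤-refl)

sumUpTo-≡0 : ∀ {f} m → (∀ i → 1 ≤ i → i ≤ m → f i ≡ 0) → sumUpTo f m ≡ 0
sumUpTo-≡0 zero    f≗0 = refl
sumUpTo-≡0 (suc m) f≗0 =
  cong₂ _+_ (sumUpTo-≡0 m (λ i 1≤i i≤m → f≗0 i 1≤i (m≤n⇒m≤1+n i≤m))) (f≗0 (suc m) z<s ≤-refl)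

sumUpTo-mono-≤ : ∀ {f g} m → (∀ i → f i ≤ g i) → sumUpTo f m ≤ sumUpTo g m
sumUpTo-mono-≤ zero    f≤g = z≤n
sumUpTo-mono-≤ (suc m) f≤g = +-mono-≤ (sumUpTo-mono-≤ m f≤g) (f≤g (suc m))

sumUpTo-+ : ∀ f g m → sumUpTo (λ i → f i + g i) m ≡ sumUpTo f m + sumUpTo g m
sumUpTo-+ f g zero    = refl
sumUpTo-+ f g (suc m) =
  trans (cong (_+ (f (suc m) + g (suc m))) (sumUpTo-+ f g m)) (interchange (sumUpTo f m) (sumUpTo g m) (f (suc m)) (g (suc m)))

sumUpTo-comm : ∀ (g : ℕ → ℕ → ℕ) m n →
  sumUpTo (λ i → sumUpTo (g i) n) m ≡ sumUpTo (λ j → sumUpTo (λ i → g i j) m) n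
sumUpTo-comm g zero    n = sym (sumUpTo-≡0 n (λ _ _ _ → refl))
sumUpTo-comm g (suc m) n =
  trans (cong (_+ sumUpTo (g (suc m)) n) (sumUpTo-comm g m n)) (sym (sumUpTo-+ _ (g (suc m)) n))

sumUpTo-𝟙≤ : ∀ t n → sumUpTo (λ e → 𝟙 (e ≤? t)) n ≡ n ⊓ t
sumUpTo-𝟙≤ t zero = refl
sumUpTo-𝟙≤ t (suc n) with suc n ≤? t
... | yes 1+n≤t = begin
  sumUpTo (λ e → 𝟙 (e ≤? t)) n + 1 ≡⟨ cong (_+ 1) (sumUpTo-𝟙≤ t n) ⟩
  n ⊓ t + 1                          ≡⟨ cong (_+ 1) (m≤n⇒m⊓n≡m (<⇒≤ 1+n≤t)) ⟩
  n + 1                              ≡⟨ +-comm n 1 ⟩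
  suc n                              ≡⟨ m≤n⇒m⊓n≡m 1+n≤t ⟨
  suc n ⊓ t                          ∎
  where open ≡-Reasoning
... | no 1+n≰t = begin
  sumUpTo (λ e → 𝟙 (e ≤? t)) n + 0 ≡⟨ +-identityʳ _ ⟩
  sumUpTo (λ e → 𝟙 (e ≤? t)) n     ≡⟨ sumUpTo-𝟙≤ t n ⟩
  n ⊓ t                              ≡⟨ m≥n⇒m⊓n≡n t≤n ⟩
  t                                  ≡⟨ m≥n⇒m⊓n≡n (m≤n⇒m≤1+n t≤n) ⟨
  suc n ⊓ t                          ∎
  where
  open ≡-Reasoning
  t≤n = ≤-pred (≰⇒> 1+n≰t)

m<[1+m/n]*n : ∀ m n .{{_ : NonZero n}} → m < suc (m / n) * n
m<[1+m/n]*n m n = begin-strict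
  m                 ≡⟨ m≡m%n+[m/n]*n m n ⟩
  m % n + m / n * n <⟨ +-monoˡ-< (m / n * n) (m%n<n m n) ⟩
  n + m / n * n     ∎
  where open ≤-Reasoning

*≤⇒≤/ : ∀ {q m} n .{{_ : NonZero n}} → q * n ≤ m → q ≤ m / n
*≤⇒≤/ {q} n q*n≤m = subst (_≤ _) (m*n/n≡m q n) (/-monoˡ-≤ n q*n≤m)

m/o+n/o≤[m+n]/o : ∀ m n o .{{_ : NonZero o}} → m / o + n / o ≤ (m + n) / o
m/o+n/o≤[m+n]/o m n o = *≤⇒≤/ o (begin
  (m / o + n / o) * o   ≡⟨ *-distribʳ-+ o (m / o) (n / o) ⟩
  m / o * o + n / o * o ≤⟨ +-mono-≤ (m/n*n≤m m o) (m/n*n≤m n o) ⟩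
  m + n                 ∎)
  where open ≤-Reasoning

[m+n]/o≤1+m/o+n/o : ∀ m n o .{{_ : NonZero o}} → (m + n) / o ≤ suc (m / o + n / o)
[m+n]/o≤1+m/o+n/o m n o = m<1+n⇒m≤n (m<n*o⇒m/o<n (begin-strict
  m + n                             <⟨ +-mono-< (m<[1+m/n]*n m o) (m<[1+m/n]*n n o) ⟩
  suc (m / o) * o + suc (n / o) * o ≡⟨ regroup (m / o) (n / o) o ⟩
  suc (suc (m / o + n / o)) * o     ∎))
  where
  open ≤-Reasoning
  regroup : ∀ x y o → suc x * o + suc y * o ≡ suc (suc (x + y)) * o
  regroup = solve-∀

[1+m]/n≡𝟙+m/n : ∀ m n .{{_ : NonZero n}} → suc m / n ≡ 𝟙 (n ∣? suc m) + m / n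
[1+m]/n≡𝟙+m/n m n with n ∣? suc m
... | yes n∣1+m = ≤-antisym (m<1+n⇒m≤n (m<n*o⇒m/o<n (begin-strict
        suc m              ≤⟨ m<[1+m/n]*n m n ⟩
        suc (m / n) * n    <⟨ m<n+m _ (>-nonZero⁻¹ n) ⟩
        n + suc (m / n) * n ∎)))
      (*≤⇒≤/ n (begin
        suc (m / n) * n ≤⟨ *-monoˡ-≤ n (*-cancelʳ-< n (m / n) q m/n*n<q*n) ⟩
        q * n           ≡⟨ m∣n⇒n≡quotient*m n∣1+m ⟨
        suc m           ∎))
  where
  open ≤-Reasoning
  q = quotient n∣1+m
  m/n*n<q*n : m / n * n < q * n
  m/n*n<q*n = begin-strict
    m / n * n ≤⟨ m/n*n≤m m n ⟩
    m         <⟨ n<1+n m ⟩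
    suc m     ≡⟨ m∣n⇒n≡quotient*m n∣1+m ⟩
    q * n     ∎
... | no n∤1+m = ≤-antisym
      (m<1+n⇒m≤n (m<n*o⇒m/o<n (≤∧≢⇒< (m<[1+m/n]*n m n) (n∤1+m ∘ divides (suc (m / n))))))
      (/-monoˡ-≤ n (n≤1+n m))

multiplesUpTo : ℕ → ℕ → ℕ
multiplesUpTo d m = sumUpTo (λ i → 𝟙 (d ∣? i)) m

multiplesUpTo[0]≡0 : ∀ m → multiplesUpTo 0 m ≡ 0
multiplesUpTo[0]≡0 m = sumUpTo-≡0 m (λ i 1≤i _ → 𝟙-no (<⇒≢ 1≤i ∘ sym ∘ 0∣⇒≡0) (0 ∣? i))

multiplesUpTo≡/ : ∀ d .{{_ : NonZero d}} m → multiplesUpTo d m ≡ m / d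
multiplesUpTo≡/ d zero    = sym (0/n≡0 d)
multiplesUpTo≡/ d (suc m) = begin
  multiplesUpTo d m + 𝟙 (d ∣? suc m) ≡⟨ +-comm (multiplesUpTo d m) _ ⟩
  𝟙 (d ∣? suc m) + multiplesUpTo d m ≡⟨ cong (𝟙 (d ∣? suc m) +_) (multiplesUpTo≡/ d m) ⟩
  𝟙 (d ∣? suc m) + m / d             ≡⟨ [1+m]/n≡𝟙+m/n m d ⟨
  suc m / d                          ∎
  where open ≡-Reasoning

multiplesUpTo-superadditive : ∀ d k s →
  multiplesUpTo d k + multiplesUpTo d s ≤ multiplesUpTo d (k + s)
multiplesUpTo-superadditive zero k s
  rewrite multiplesUpTo[0]≡0 k | multiplesUpTo[0]≡0 s | multiplesUpTo[0]≡0 (k + s) = z≤n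
multiplesUpTo-superadditive d@(suc _) k s =
  subst₂ _≤_ (sym (cong₂ _+_ (multiplesUpTo≡/ d k) (multiplesUpTo≡/ d s))) (sym (multiplesUpTo≡/ d (k + s)))
    (m/o+n/o≤[m+n]/o k s d)

multiplesUpTo-almost-subadditive : ∀ d k s →
  𝟙 (d ∣? k) + multiplesUpTo d (k + s) ≤ 1 + (multiplesUpTo d k + multiplesUpTo d s)
multiplesUpTo-almost-subadditive zero k s
  rewrite multiplesUpTo[0]≡0 (k + s) | multiplesUpTo[0]≡0 k | multiplesUpTo[0]≡0 s
        | +-identityʳ (𝟙 (0 ∣? k)) = 𝟙≤1 (0 ∣? k)
multiplesUpTo-almost-subadditive d@(suc _) k s with d ∣? k
... | yes d∣k = s≤s (≤-reflexive (begin
  multiplesUpTo d (k + s)               ≡⟨ multiplesUpTo≡/ d (k + s) ⟩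
  (k + s) / d                           ≡⟨ +-distrib-/-∣ˡ s d∣k ⟩
  k / d + s / d                         ≡⟨ cong₂ _+_ (multiplesUpTo≡/ d k) (multiplesUpTo≡/ d s) ⟨
  multiplesUpTo d k + multiplesUpTo d s ∎))
  where open ≡-Reasoning
... | no _ =
  subst₂ _≤_ (sym (multiplesUpTo≡/ d (k + s)))
    (sym (cong suc (cong₂ _+_ (multiplesUpTo≡/ d k) (multiplesUpTo≡/ d s))))
    ([m+n]/o≤1+m/o+n/o k s d)

GcdClosed : (ℕ → Set) → Set
GcdClosed Q = ∀ {m n} → 1 ≤ m → 1 ≤ n → Q m → Q n → Q (gcd m n)

MultipleClosed : (ℕ → Set) → Set
MultipleClosed Q = ∀ {d m} → 1 ≤ d → 1 ≤ m → Q d → d ∣ m → Q m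

module _ {Q : ℕ → Set} (Q? : Decidable Q) where

  gcdOfUpTo : ℕ → ℕ
  gcdOfUpTo zero = 0
  gcdOfUpTo (suc n) with Q? (suc n)
  ... | yes _ = gcd (gcdOfUpTo n) (suc n)
  ... | no _  = gcdOfUpTo n

  gcdOfUpTo-∣ : ∀ {m} n → 1 ≤ m → m ≤ n → Q m → gcdOfUpTo n ∣ m
  gcdOfUpTo-∣ zero    1≤m m≤0 _ = contradiction m≤0 (<⇒≱ 1≤m)
  gcdOfUpTo-∣ (suc n) 1≤m m≤1+n Qm with Q? (suc n) | m≤n⇒m<n∨m≡n m≤1+n
  ... | yes _  | inj₁ m≤n = ∣-trans (gcd[m,n]∣m _ _) (gcdOfUpTo-∣ n 1≤m (≤-pred m≤n) Qm)
  ... | yes _  | inj₂ refl = gcd[m,n]∣n (gcdOfUpTo n) (suc n)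
  ... | no _   | inj₁ m≤n = gcdOfUpTo-∣ n 1≤m (≤-pred m≤n) Qm
  ... | no ¬Qm | inj₂ refl = contradiction Qm ¬Qm

  gcdOfUpTo-satisfies : GcdClosed Q → ∀ n → 1 ≤ gcdOfUpTo n → Q (gcdOfUpTo n)
  gcdOfUpTo-satisfies Q-gcd zero ()
  gcdOfUpTo-satisfies Q-gcd (suc n) 1≤G with Q? (suc n)
  ... | no _ = gcdOfUpTo-satisfies Q-gcd n 1≤G
  ... | yes Q[1+n] with gcdOfUpTo n ≟ 0
  ...   | yes G≡0 = subst Q (trans (sym (gcd-identityˡ (suc n))) (cong (λ g → gcd g (suc n)) (sym G≡0))) Q[1+n]
  ...   | no G≢0  = Q-gcd (n≢0⇒n>0 G≢0) z<s (gcdOfUpTo-satisfies Q-gcd n (n≢0⇒n>0 G≢0)) Q[1+n]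

  satisfies⇔gcdOfUpTo-∣ : GcdClosed Q → MultipleClosed Q →
    ∀ {m} n → 1 ≤ m → m ≤ n → Q m ⇔ gcdOfUpTo n ∣ m
  satisfies⇔gcdOfUpTo-∣ Q-gcd Q-multiple {m} n 1≤m m≤n = mk⇔ (gcdOfUpTo-∣ n 1≤m m≤n) from
    where
    from : gcdOfUpTo n ∣ m → Q m
    from G∣m = Q-multiple 1≤G 1≤m (gcdOfUpTo-satisfies Q-gcd n 1≤G) G∣m
      where
      1≤G : 1 ≤ gcdOfUpTo n
      1≤G = n≢0⇒n>0 (λ G≡0 → <⇒≢ 1≤m (sym (0∣⇒≡0 (subst (_∣ m) G≡0 G∣m))))

-- The multiplicity of p in x (for p > 1, x > 0); fuel x suffices since each step divides x by p.
νᶠ : (p fuel x : ℕ) → ℕ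
νᶠ p zero       x = 0
νᶠ p (suc fuel) x with p ∣? x
... | yes p∣x = suc (νᶠ p fuel (quotient p∣x))
... | no _    = 0

ν : ℕ → ℕ → ℕ
ν p x = νᶠ p x x

νᶠ-spec : ∀ p .{{_ : NonTrivial p}} fuel x .{{_ : NonZero x}} → x ≤ fuel →
  p ^ νᶠ p fuel x ∣ x × ¬ p ^ suc (νᶠ p fuel x) ∣ x
νᶠ-spec p zero (suc x) ()
νᶠ-spec p (suc fuel) x x≤1+fuel with p ∣? x
... | no p∤x  = 1∣ x , p∤x ∘ subst (_∣ x) (*-identityʳ p)
... | yes p∣x =
  subst (p ^ suc g ∣_) (sym x≡p*q) (*-monoʳ-∣ p p^g∣q) ,
  λ p^[2+g]∣x → p^[1+g]∤q (*-cancelˡ-∣ p {{nonTrivial⇒nonZero p}} (subst (p * p ^ suc g ∣_) x≡p*q p^[2+g]∣x))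
  where
  q = quotient p∣x
  instance q≢0 = quotient≢0 p∣x
  x≡p*q = m∣n⇒n≡m*quotient p∣x
  ih = νᶠ-spec p fuel q (m<1+n⇒m≤n (<-≤-trans (quotient-< p∣x) x≤1+fuel))
  g = νᶠ p fuel q
  p^g∣q = proj₁ ih
  p^[1+g]∤q = proj₂ ih

^-monoʳ-∣ : ∀ p {m n} → m ≤ n → p ^ m ∣ p ^ n
^-monoʳ-∣ p {m} {n} m≤n =
  divides (p ^ (n ∸ m)) (trans (cong (p ^_) (sym (m+[n∸m]≡n m≤n)))
                               (trans (^-distribˡ-+-* p m (n ∸ m)) (*-comm (p ^ m) _)))

module _ {p : ℕ} (p-prime : Prime p) where

  private instance
    p-nonTrivial : NonTrivial p
    p-nonTrivial = prime⇒nonTrivial p-prime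

  ν-spec : ∀ {x} → 0 < x → p ^ ν p x ∣ x × ¬ p ^ suc (ν p x) ∣ x
  ν-spec {x} x>0 = νᶠ-spec p x x {{>-nonZero x>0}} ≤-refl

  ≤ν⇒^∣ : ∀ {e x} → 0 < x → e ≤ ν p x → p ^ e ∣ x
  ≤ν⇒^∣ x>0 e≤ν = ∣-trans (^-monoʳ-∣ p e≤ν) (proj₁ (ν-spec x>0))

  ^∣⇒≤ν : ∀ {e x} → 0 < x → p ^ e ∣ x → e ≤ ν p x
  ^∣⇒≤ν x>0 p^e∣x = ≮⇒≥ (λ ν<e → proj₂ (ν-spec x>0) (∣-trans (^-monoʳ-∣ p ν<e) p^e∣x))

  ν-cofactor : ∀ {x} → 0 < x → ∃[ u ] x ≡ p ^ ν p x * u × ¬ p ∣ u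
  ν-cofactor {x} x>0 = quotient p^ν∣x , x≡p^ν*u , p∤u
    where
    p^ν∣x = proj₁ (ν-spec x>0)
    x≡p^ν*u = m∣n⇒n≡m*quotient p^ν∣x
    p∤u : ¬ p ∣ quotient p^ν∣x
    p∤u p∣u = proj₂ (ν-spec x>0)
      (subst₂ _∣_ (*-comm (p ^ ν p x) p) (sym x≡p^ν*u) (*-monoʳ-∣ (p ^ ν p x) p∣u))

  ν-* : ∀ {x y} → 0 < x → 0 < y → ν p (x * y) ≡ ν p x + ν p y
  ν-* {x} {y} x>0 y>0 = ≤-antisym (≮⇒≥ (p^[1+s+t]∤xy ∘ ≤ν⇒^∣ xy>0)) s+t≤ν
    where
    xy>0 = *-mono-< x>0 y>0
    s = ν p x
    t = ν p y
    s+t≤ν : s + t ≤ ν p (x * y)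
    s+t≤ν = ^∣⇒≤ν xy>0 (subst (_∣ x * y) (sym (^-distribˡ-+-* p s t))
                              (*-pres-∣ (proj₁ (ν-spec x>0)) (proj₁ (ν-spec y>0))))
    p^[1+s+t]∤xy : ¬ p ^ suc (s + t) ∣ x * y
    p^[1+s+t]∤xy p^[1+s+t]∣xy with ν-cofactor x>0 | ν-cofactor y>0
    ... | u , x≡ , p∤u | w , y≡ , p∤w =
      [ p∤u , p∤w ]′ (euclidsLemma u w p-prime (*-cancelˡ-∣ (p ^ (s + t)) {{m^n≢0 p (s + t) {{nonTrivial⇒nonZero p}}}}
        (subst₂ _∣_ (*-comm p (p ^ (s + t))) xy≡ p^[1+s+t]∣xy)))
      where
      regroup : ∀ a u b w → (a * u) * (b * w) ≡ (a * b) * (u * w)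
      regroup = solve-∀
      xy≡ : x * y ≡ p ^ (s + t) * (u * w)
      xy≡ = trans (cong₂ _*_ x≡ y≡)
                  (trans (regroup (p ^ s) u (p ^ t) w) (cong (_* (u * w)) (sym (^-distribˡ-+-* p s t))))

  ν-mono-∣ : ∀ {x y} → 0 < x → 0 < y → x ∣ y → ν p x ≤ ν p y
  ν-mono-∣ x>0 y>0 x∣y = ^∣⇒≤ν y>0 (∣-trans (proj₁ (ν-spec x>0)) x∣y)

  ν[1]≡0 : ν p 1 ≡ 0
  ν[1]≡0 = n<1⇒n≡0 (≰⇒> (λ 1≤ν → nonTrivial⇒≢1 (∣1⇒≡1 (subst (_∣ 1) (*-identityʳ p) (≤ν⇒^∣ z<s 1≤ν)))))

  sumUpTo-𝟙^∣≡⊓ν : ∀ {x} → 0 < x → ∀ B → sumUpTo (λ e → 𝟙 (p ^ e ∣? x)) B ≡ B ⊓ ν p x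
  sumUpTo-𝟙^∣≡⊓ν {x} x>0 B = trans
    (sumUpTo-cong B (λ e _ _ → 𝟙-cong (mk⇔ (^∣⇒≤ν x>0) (≤ν⇒^∣ x>0)) (p ^ e ∣? x) (e ≤? ν p x)))
    (sumUpTo-𝟙≤ (ν p x) B)

  sumUpTo-𝟙^∣≡ν : ∀ {x B} → 0 < x → ν p x ≤ B → sumUpTo (λ e → 𝟙 (p ^ e ∣? x)) B ≡ ν p x
  sumUpTo-𝟙^∣≡ν x>0 ν≤B = trans (sumUpTo-𝟙^∣≡⊓ν x>0 _) (m≥n⇒m⊓n≡n ν≤B)

  sumUpTo-𝟙^∣≤ν : ∀ {x} → 0 < x → ∀ B → sumUpTo (λ e → 𝟙 (p ^ e ∣? x)) B ≤ ν p x
  sumUpTo-𝟙^∣≤ν {x} x>0 B = subst (_≤ ν p x) (sym (sumUpTo-𝟙^∣≡⊓ν x>0 B)) (m⊓n≤n B (ν p x))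

product-∣ : ∀ {ps y} → All Prime ps → 0 < y → (∀ {p} → Prime p → ν p (product ps) ≤ ν p y) →
  product ps ∣ y
product-∣ {[]} {y} [] _ _ = 1∣ y
product-∣ {p ∷ ps} {y} (p-prime ∷ ps-prime) y>0 ν≤ =
  subst (p * product ps ∣_) (sym y≡p*y′) (*-monoʳ-∣ p (product-∣ ps-prime y′>0 ν≤′))
  where
  p>0 = >-nonZero⁻¹ p {{prime⇒nonZero p-prime}}
  P>0 = productOfPrimes≥1 ps-prime
  1≤ν[y] : 1 ≤ ν p y
  1≤ν[y] = begin
    1                                ≤⟨ ^∣⇒≤ν p-prime p>0 (subst (_∣ p) (sym (*-identityʳ p)) ∣-refl) ⟩
    ν p p                            ≤⟨ m≤m+n _ _ ⟩
    ν p p + ν p (product ps)         ≡⟨ ν-* p-prime p>0 P>0 ⟨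
    ν p (p * product ps)             ≤⟨ ν≤ p-prime ⟩
    ν p y                            ∎
    where open ≤-Reasoning
  p∣y : p ∣ y
  p∣y = subst (_∣ y) (*-identityʳ p) (≤ν⇒^∣ p-prime y>0 1≤ν[y])
  y′ = quotient p∣y
  y≡p*y′ = m∣n⇒n≡m*quotient p∣y
  y′>0 = >-nonZero⁻¹ y′ {{quotient≢0 p∣y {{>-nonZero y>0}}}}
  ν≤′ : ∀ {q} → Prime q → ν q (product ps) ≤ ν q y′
  ν≤′ {q} q-prime = +-cancelˡ-≤ (ν q p) _ _
    (subst₂ _≤_ (ν-* q-prime p>0 P>0) (trans (cong (ν q) y≡p*y′) (ν-* q-prime p>0 y′>0)) (ν≤ q-prime))

ν≤ν⇒∣ : ∀ {x y} → 0 < x → 0 < y → (∀ {p} → Prime p → ν p x ≤ ν p y) → x ∣ y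
ν≤ν⇒∣ {x} x>0 y>0 ν≤ =
  subst (_∣ _) (sym x≡) (product-∣ (factorsPrime F) y>0 (λ pr → subst (λ z → ν _ z ≤ _) x≡ (ν≤ pr)))
  where
  open PrimeFactorisation
  F = factorise x {{>-nonZero x>0}}
  x≡ = isFactorisation F

prodInit-positive : ∀ {a} → Positive a → ∀ m → 0 < prodInit a m
prodInit-positive {a} a>0 m = >-nonZero⁻¹ _ {{prodInit-nonZero a a>0 m}}

a∣prodInit : ∀ a {i} n → 1 ≤ i → i ≤ n → a i ∣ prodInit a n
a∣prodInit a zero    1≤i i≤0 = contradiction i≤0 (<⇒≱ 1≤i)
a∣prodInit a (suc n) 1≤i i≤1+n with m≤n⇒m<n∨m≡n i≤1+n
... | inj₁ i≤n  = ∣-trans (a∣prodInit a n 1≤i (≤-pred i≤n)) (m∣m*n (a (suc n)))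
... | inj₂ refl = n∣m*n (prodInit a n)

ν-prodInit : ∀ {p a} → Prime p → Positive a → ∀ m → ν p (prodInit a m) ≡ sumUpTo (λ i → ν p (a i)) m
ν-prodInit p-prime a>0 zero    = ν[1]≡0 p-prime
ν-prodInit {p} {a} p-prime a>0 (suc m) =
  trans (ν-* p-prime (prodInit-positive a>0 m) (a>0 (suc m) z<s))
        (cong (_+ ν p (a (suc m))) (ν-prodInit p-prime a>0 m))

fallProd*prodInit : ∀ a {n} k → k ≤ n → fallProd a n k * prodInit a (n ∸ k) ≡ prodInit a n
fallProd*prodInit a zero    _   = *-identityˡ _
fallProd*prodInit a {n} (suc k) k<n = begin
  a (n ∸ k) * F * P j       ≡⟨ regroup (a (n ∸ k)) F (P j) ⟩
  F * (P j * a (n ∸ k))     ≡⟨ cong (λ i → F * (P j * a i)) n∸k≡1+j ⟩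
  F * P (suc j)             ≡⟨ cong (λ i → F * P i) n∸k≡1+j ⟨
  F * P (n ∸ k)             ≡⟨ fallProd*prodInit a k (<⇒≤ k<n) ⟩
  P n                       ∎
  where
  open ≡-Reasoning
  F = fallProd a n k
  P = prodInit a
  j = n ∸ suc k
  n∸k≡1+j : n ∸ k ≡ suc j
  n∸k≡1+j = +-∸-assoc 1 k<n
  regroup : ∀ x y z → x * y * z ≡ y * (z * x)
  regroup = solve-∀

lcm-positive : ∀ {m n} → 0 < m → 0 < n → 0 < lcm m n
lcm-positive {m} {n} m>0 n>0 = n≢0⇒n>0 λ lcm≡0 → <⇒≢ (*-mono-< m>0 n>0) (sym (begin
  m * n             ≡⟨ gcd*lcm m n ⟨
  gcd m n * lcm m n ≡⟨ cong (gcd m n *_) lcm≡0 ⟩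
  gcd m n * 0       ≡⟨ *-zeroʳ (gcd m n) ⟩
  0                 ∎))
  where open ≡-Reasoning

lcmUpTo-positive : ∀ {f} → Positive f → ∀ n → 0 < lcmUpTo f n
lcmUpTo-positive f>0 zero    = z<s
lcmUpTo-positive f>0 (suc n) = lcm-positive (lcmUpTo-positive f>0 n) (f>0 (suc n) z<s)

lcmUpTo-∣ : ∀ f {i} n → 1 ≤ i → i ≤ n → f i ∣ lcmUpTo f n
lcmUpTo-∣ f zero    1≤i i≤0 = contradiction i≤0 (<⇒≱ 1≤i)
lcmUpTo-∣ f (suc n) 1≤i i≤1+n with m≤n⇒m<n∨m≡n i≤1+n
... | inj₁ i≤n  = ∣-trans (lcmUpTo-∣ f n 1≤i (≤-pred i≤n)) (m∣lcm[m,n] (lcmUpTo f n) (f (suc n)))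
... | inj₂ refl = n∣lcm[m,n] (lcmUpTo f n) (f (suc n))

lcmUpTo-least : ∀ f n {c} → (∀ i → 1 ≤ i → i ≤ n → f i ∣ c) → lcmUpTo f n ∣ c
lcmUpTo-least f zero    {c} _    = 1∣ c
lcmUpTo-least f (suc n)     f∣c =
  lcm-least (lcmUpTo-least f n (λ i 1≤i i≤n → f∣c i 1≤i (m≤n⇒m≤1+n i≤n))) (f∣c (suc n) z<s ≤-refl)

module _ (a : ℕ → ℕ) (sds : IsStrongDivisibilitySequence a) where

  private
    a>0 : Positive a
    a>0 = proj₁ sds

  a-mono-∣ : ∀ {d m} → 1 ≤ d → 1 ≤ m → d ∣ m → a d ∣ a m
  a-mono-∣ {d} {m} 1≤d 1≤m d∣m = subst (_∣ a m) gcd[ad,am]≡ad (gcd[m,n]∣n (a d) (a m))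
    where
    gcd[ad,am]≡ad : gcd (a d) (a m) ≡ a d
    gcd[ad,am]≡ad = trans (proj₂ sds d m 1≤d 1≤m)
                          (cong a (∣-antisym (gcd[m,n]∣m d m) (gcd-greatest ∣-refl d∣m)))

  module _ {p : ℕ} (p-prime : Prime p) (n : ℕ) where

    private
      L B : ℕ
      L = lcmUpTo a n
      B = ν p (prodInit a n)

    count : ℕ → ℕ → ℕ
    count e m = sumUpTo (λ i → 𝟙 (p ^ e ∣? a i)) m

    -- the rank of apparition of p ^ e if it is at most n, and 0 otherwise
    rank : ℕ → ℕ
    rank e = gcdOfUpTo (λ i → p ^ e ∣? a i) n

    ^∣a⇔rank∣ : ∀ e {i} → 1 ≤ i → i ≤ n → p ^ e ∣ a i ⇔ rank e ∣ i
    ^∣a⇔rank∣ e = satisfies⇔gcdOfUpTo-∣ (λ i → p ^ e ∣? a i)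
      (λ 1≤m 1≤m′ p^e∣am p^e∣am′ → subst (p ^ e ∣_) (proj₂ sds _ _ 1≤m 1≤m′) (gcd-greatest p^e∣am p^e∣am′))
      (λ 1≤d 1≤m p^e∣ad d∣m → ∣-trans p^e∣ad (a-mono-∣ 1≤d 1≤m d∣m))
      n

    count≡multiplesUpTo : ∀ e {m} → m ≤ n → count e m ≡ multiplesUpTo (rank e) m
    count≡multiplesUpTo e {m} m≤n =
      sumUpTo-cong m (λ i 1≤i i≤m → 𝟙-cong (^∣a⇔rank∣ e 1≤i (≤-trans i≤m m≤n)) _ _)

    count-superadditive : ∀ e {k} → k ≤ n → count e k + count e (n ∸ k) ≤ count e n
    count-superadditive e {k} k≤n = begin
      count e k + count e (n ∸ k) ≡⟨ cong₂ _+_ (count≡multiplesUpTo e k≤n) (count≡multiplesUpTo e (m∸n≤m n k)) ⟩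
      M k + M (n ∸ k)             ≤⟨ multiplesUpTo-superadditive (rank e) k (n ∸ k) ⟩
      M (k + (n ∸ k))             ≡⟨ cong M (m+[n∸m]≡n k≤n) ⟩
      M n                         ≡⟨ count≡multiplesUpTo e ≤-refl ⟨
      count e n                   ∎
      where
      open ≤-Reasoning
      M = multiplesUpTo (rank e)

    count-almost-subadditive : ∀ e {k} → 1 ≤ k → k ≤ n →
      𝟙 (p ^ e ∣? a k) + count e n ≤ 𝟙 (p ^ e ∣? L) + (count e k + count e (n ∸ k))
    count-almost-subadditive e {k} 1≤k k≤n with p ^ e ∣? L
    ... | no p^e∤L = subst (_≤ count e k + count e (n ∸ k)) (sym (cong₂ _+_ (𝟙-no (p^e∤a 1≤k k≤n) _)
                                                  (sumUpTo-≡0 n (λ i 1≤i i≤n → 𝟙-no (p^e∤a 1≤i i≤n) _)))) z≤n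
      where
      p^e∤a : ∀ {i} → 1 ≤ i → i ≤ n → ¬ p ^ e ∣ a i
      p^e∤a 1≤i i≤n p^e∣ai = p^e∤L (∣-trans p^e∣ai (lcmUpTo-∣ a n 1≤i i≤n))
    ... | yes _ = begin
      𝟙 (p ^ e ∣? a k) + count e n      ≡⟨ cong₂ _+_ (𝟙-cong (^∣a⇔rank∣ e 1≤k k≤n) _ _) (count≡multiplesUpTo e ≤-refl) ⟩
      𝟙 (rank e ∣? k) + M n             ≡⟨ cong (λ m → 𝟙 (rank e ∣? k) + M m) (m+[n∸m]≡n k≤n) ⟨
      𝟙 (rank e ∣? k) + M (k + (n ∸ k)) ≤⟨ multiplesUpTo-almost-subadditive (rank e) k (n ∸ k) ⟩
      1 + (M k + M (n ∸ k))             ≡⟨ cong (1 +_) (cong₂ _+_ (count≡multiplesUpTo e k≤n)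
                                                                   (count≡multiplesUpTo e (m∸n≤m n k))) ⟨
      1 + (count e k + count e (n ∸ k)) ∎
      where
      open ≤-Reasoning
      M = multiplesUpTo (rank e)

    ν-prodInit≡sumUpTo-count : ∀ {m} → m ≤ n → ν p (prodInit a m) ≡ sumUpTo (λ e → count e m) B
    ν-prodInit≡sumUpTo-count {m} m≤n = begin
      ν p (prodInit a m)                                    ≡⟨ ν-prodInit p-prime a>0 m ⟩
      sumUpTo (λ i → ν p (a i)) m                           ≡⟨ sumUpTo-cong m ν[ai]≡ ⟩
      sumUpTo (λ i → sumUpTo (λ e → 𝟙 (p ^ e ∣? a i)) B) m ≡⟨ sumUpTo-comm (λ i e → 𝟙 (p ^ e ∣? a i)) m B ⟩
      sumUpTo (λ e → count e m) B                           ∎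
      where
      open ≡-Reasoning
      ν[ai]≡ : ∀ i → 1 ≤ i → i ≤ m → ν p (a i) ≡ sumUpTo (λ e → 𝟙 (p ^ e ∣? a i)) B
      ν[ai]≡ i 1≤i i≤m = sym (sumUpTo-𝟙^∣≡ν p-prime (a>0 i 1≤i)
        (ν-mono-∣ p-prime (a>0 i 1≤i) (prodInit-positive a>0 n) (a∣prodInit a n 1≤i (≤-trans i≤m m≤n))))

    ν-prodInit-superadditive : ∀ {k} → k ≤ n →
      ν p (prodInit a k) + ν p (prodInit a (n ∸ k)) ≤ ν p (prodInit a n)
    ν-prodInit-superadditive {k} k≤n = begin
      ν p (prodInit a k) + ν p (prodInit a (n ∸ k))
        ≡⟨ cong₂ _+_ (ν-prodInit≡sumUpTo-count k≤n) (ν-prodInit≡sumUpTo-count (m∸n≤m n k)) ⟩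
      sumUpTo (λ e → count e k) B + sumUpTo (λ e → count e (n ∸ k)) B
        ≡⟨ sumUpTo-+ _ _ B ⟨
      sumUpTo (λ e → count e k + count e (n ∸ k)) B
        ≤⟨ sumUpTo-mono-≤ B (λ e → count-superadditive e k≤n) ⟩
      sumUpTo (λ e → count e n) B
        ≡⟨ ν-prodInit≡sumUpTo-count ≤-refl ⟨
      ν p (prodInit a n) ∎
      where open ≤-Reasoning

    ν-a*prodInit≤ : ∀ {k} → 1 ≤ k → k ≤ n →
      ν p (a k) + ν p (prodInit a n) ≤ ν p L + (ν p (prodInit a k) + ν p (prodInit a (n ∸ k)))
    ν-a*prodInit≤ {k} 1≤k k≤n = begin
      ν p (a k) + ν p (prodInit a n)
        ≡⟨ cong₂ _+_ (sumUpTo-𝟙^∣≡ν p-prime (a>0 k 1≤k) ν[ak]≤B) (sym (ν-prodInit≡sumUpTo-count ≤-refl)) ⟨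
      sumUpTo (λ e → 𝟙 (p ^ e ∣? a k)) B + sumUpTo (λ e → count e n) B
        ≡⟨ sumUpTo-+ _ _ B ⟨
      sumUpTo (λ e → 𝟙 (p ^ e ∣? a k) + count e n) B
        ≤⟨ sumUpTo-mono-≤ B (λ e → count-almost-subadditive e 1≤k k≤n) ⟩
      sumUpTo (λ e → 𝟙 (p ^ e ∣? L) + (count e k + count e (n ∸ k))) B
        ≡⟨ sumUpTo-+ _ _ B ⟩
      sumUpTo (λ e → 𝟙 (p ^ e ∣? L)) B + sumUpTo (λ e → count e k + count e (n ∸ k)) B
        ≤⟨ +-mono-≤ (sumUpTo-𝟙^∣≤ν p-prime (lcmUpTo-positive a>0 n) B) (≤-reflexive (sumUpTo-+ _ _ B)) ⟩
      ν p L + (sumUpTo (λ e → count e k) B + sumUpTo (λ e → count e (n ∸ k)) B)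
        ≡⟨ cong (ν p L +_) (cong₂ _+_ (ν-prodInit≡sumUpTo-count k≤n)
                                      (ν-prodInit≡sumUpTo-count (m∸n≤m n k))) ⟨
      ν p L + (ν p (prodInit a k) + ν p (prodInit a (n ∸ k))) ∎
      where
      open ≤-Reasoning
      ν[ak]≤B = ν-mono-∣ p-prime (a>0 k 1≤k) (prodInit-positive a>0 n) (a∣prodInit a n 1≤k k≤n)

  private
    P : ℕ → ℕ
    P = prodInit a
    P>0 : ∀ m → 0 < P m
    P>0 = prodInit-positive a>0

  prodInit*prodInit∣prodInit : ∀ {n k} → k ≤ n → P k * P (n ∸ k) ∣ P n
  prodInit*prodInit∣prodInit {n} {k} k≤n = ν≤ν⇒∣ (*-mono-< (P>0 k) (P>0 (n ∸ k))) (P>0 n)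
    (λ p-prime → subst (_≤ _) (sym (ν-* p-prime (P>0 k) (P>0 (n ∸ k))))
                       (ν-prodInit-superadditive p-prime n k≤n))

  a*prodInit∣lcmUpTo*prodInit*prodInit : ∀ {n k} → 1 ≤ k → k ≤ n →
    a k * P n ∣ lcmUpTo a n * (P k * P (n ∸ k))
  a*prodInit∣lcmUpTo*prodInit*prodInit {n} {k} 1≤k k≤n =
    ν≤ν⇒∣ (*-mono-< (a>0 k 1≤k) (P>0 n)) (*-mono-< L>0 (*-mono-< (P>0 k) (P>0 (n ∸ k))))
      (λ p-prime → subst₂ _≤_
        (sym (ν-* p-prime (a>0 k 1≤k) (P>0 n)))
        (sym (trans (ν-* p-prime L>0 (*-mono-< (P>0 k) (P>0 (n ∸ k))))
                    (cong (_ +_) (ν-* p-prime (P>0 k) (P>0 (n ∸ k))))))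
        (ν-a*prodInit≤ p-prime n 1≤k k≤n))
    where L>0 = lcmUpTo-positive a>0 n

  a*aBinom∣lcmUpTo : ∀ {n k} → 1 ≤ k → k ≤ n → a k * aBinom a a>0 n k ∣ lcmUpTo a n
  a*aBinom∣lcmUpTo {n} {k} 1≤k k≤n =
    *-cancelʳ-∣ (P k * P (n ∸ k)) {{>-nonZero (*-mono-< (P>0 k) (P>0 (n ∸ k)))}}
      (subst (_∣ lcmUpTo a n * (P k * P (n ∸ k))) a*P≡ (a*prodInit∣lcmUpTo*prodInit*prodInit 1≤k k≤n))
    where
    open ≡-Reasoning
    C = aBinom a a>0 n k
    C*Pk≡F : C * P k ≡ fallProd a n k
    C*Pk≡F = m/n*n≡m {{prodInit-nonZero a a>0 k}}
      (*-cancelʳ-∣ (P (n ∸ k)) {{prodInit-nonZero a a>0 (n ∸ k)}}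
        (subst (P k * P (n ∸ k) ∣_) (sym (fallProd*prodInit a k k≤n)) (prodInit*prodInit∣prodInit k≤n)))
    regroup : ∀ x c y z → x * (c * y * z) ≡ x * c * (y * z)
    regroup = solve-∀
    a*P≡ : a k * P n ≡ a k * C * (P k * P (n ∸ k))
    a*P≡ = begin
      a k * P n                    ≡⟨ cong (a k *_) (fallProd*prodInit a k k≤n) ⟨
      a k * (fallProd a n k * P (n ∸ k)) ≡⟨ cong (λ F → a k * (F * P (n ∸ k))) C*Pk≡F ⟨
      a k * (C * P k * P (n ∸ k))  ≡⟨ regroup (a k) C (P k) (P (n ∸ k)) ⟩
      a k * C * (P k * P (n ∸ k))  ∎

corollary1 : (a : ℕ → ℕ) → (sds : IsStrongDivisibilitySequence a) → (n : ℕ) → 1 ≤ n →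
    lcmUpTo a n ≡ lcmUpTo (λ k → a k * aBinom a (proj₁ sds) n k) n
corollary1 a sds n _ = ∣-antisym
  (lcmUpTo-least a n (λ i 1≤i i≤n → ∣-trans (m∣m*n _) (lcmUpTo-∣ f n 1≤i i≤n)))
  (lcmUpTo-least f n (λ i 1≤i i≤n → a*aBinom∣lcmUpTo a sds 1≤i i≤n))
  where
  f = λ k → a k * aBinom a (proj₁ sds) n k
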